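{- Let $G$ be a connected graph and let $A, B$ be two non-empty disjoint convex subsets of $V(G)$. Let $a \in A$, $b \in B$ and let $a = v_1,\dots,v_k = b$ be a shortest $ab$-path. Then $A$ and $B$ are separable if and only if there exists $1 \le i < k$ such that $\mathrm{cl}(A \cup \{v_1,\dots,v_i\})$ and $\mathrm{cl}(B\cup\{v_{i+1},\dots,v_k\})$ are separable.
   Context: All graphs are finite, undirected and loopless. A chordless $uv$-path is a $uv$-path that is an induced subgraph. A set $C \subseteq V(G)$ is convex (monophonically convex) if for all $u,v\in C$ every vertex on a chordless $uv$-path lies in $C$; $\mathrm{cl}(X)$ is the intersection of all convex sets containing $X$. A half-space is a convex set $H$ with $V(G)\setminus H$ convex. Two sets $X, Y$ are separable if there is a half-space $H$ with $X\subseteq H$ and $Y\subseteq V(G)\setminus H$. -}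

module Defs where

open import Data.Nat using (ℕ; zero; suc; _≤_; _<_)
open import Data.Fin using (Fin; zero; suc; toℕ; fromℕ; inject₁)
open import Data.Fin.Subset using (Subset; _∈_; ∁; Nonempty)
open import Data.Product using (Σ; ∃; _×_; _,_)
open import Data.Sum using (_⊎_)
open import Data.Empty using (⊥)
open import Relation.Nullary using (¬_)
open import Relation.Binary.PropositionalEquality using (_≡_)
open import Function.Definitions using (Injective)

record Graph (n : ℕ) : Set₁ where
  field
    _~_     : Fin n → Fin n → Set
    ~-sym   : ∀ {x y} → x ~ y → y ~ x
    ~-irrefl : ∀ x → ¬ (x ~ x)

VSet : ℕ → Set₁
VSet n = Fin n → Set

⟦_⟧ : ∀ {n} → Subset n → VSet n
⟦ S ⟧ x = x ∈ S

_⊆ᵥ_ : ∀ {n} → VSet n → VSet n → Set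
X ⊆ᵥ Y = ∀ x → X x → Y x

_∪ᵥ_ : ∀ {n} → VSet n → VSet n → VSet n
(X ∪ᵥ Y) x = X x ⊎ Y x

module _ {n : ℕ} (G : Graph n) where
  open Graph G

  IsPath : ∀ {m} → (Fin (suc m) → Fin n) → Set
  IsPath {m} p = Injective _≡_ _≡_ p × (∀ (i : Fin m) → p (inject₁ i) ~ p (suc i))

  Ends : ∀ {m} → (Fin (suc m) → Fin n) → Fin n → Fin n → Set
  Ends {m} p u v = (p zero ≡ u) × (p (fromℕ m) ≡ v)

  IsChordless : ∀ {m} → (Fin (suc m) → Fin n) → Set
  IsChordless p = IsPath p ×
    (∀ i j → p i ~ p j → (toℕ j ≡ suc (toℕ i)) ⊎ (toℕ i ≡ suc (toℕ j)))

  Connected : Set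
  Connected = ∀ u v → Σ ℕ λ m → Σ (Fin (suc m) → Fin n) λ p → IsPath p × Ends p u v

  IsShortestPath : ∀ {m} → (Fin (suc m) → Fin n) → Fin n → Fin n → Set
  IsShortestPath {m} p u v = IsPath p × Ends p u v ×
    (∀ m' (q : Fin (suc m') → Fin n) → IsPath q → Ends q u v → m ≤ m')

  Convex : VSet n → Set
  Convex C = ∀ m (p : Fin (suc m) → Fin n) → IsChordless p →
    C (p zero) → C (p (fromℕ m)) → ∀ j → C (p j)

  cl : VSet n → VSet n
  cl X v = ∀ (C : Subset n) → Convex ⟦ C ⟧ → X ⊆ᵥ ⟦ C ⟧ → v ∈ C

  HalfSpace : Subset n → Set
  HalfSpace H = Convex ⟦ H ⟧ × Convex ⟦ ∁ H ⟧

  Separable : VSet n → VSet n → Set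
  Separable X Y = Σ (Subset n) λ H → HalfSpace H × X ⊆ᵥ ⟦ H ⟧ × Y ⊆ᵥ ⟦ ∁ H ⟧

-- {v_1,…,v_i} (1-based) = vertices p j with toℕ j < i
Prefix : ∀ {n m} → (Fin (suc m) → Fin n) → ℕ → VSet n
Prefix p i v = Σ _ λ j → (toℕ j < i) × (p j ≡ v)

-- {v_{i+1},…,v_k} (1-based) = vertices p j with i ≤ toℕ j
Suffix : ∀ {n m} → (Fin (suc m) → Fin n) → ℕ → VSet n
Suffix p i v = Σ _ λ j → (i ≤ toℕ j) × (p j ≡ v)

Disjoint : ∀ {n} → Subset n → Subset n → Set
Disjoint A B = ∀ x → x ∈ A → x ∈ B → ⊥

{-# OPTIONS --safe #-}
-- A shortest path is chordless, since a chord v_i v_j with j > i + 1 would cut out a shorter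
-- path. If a chordless path starts in a convex set H and is in H again at v_j, its initial
-- segment up to v_j is a chordless path with both ends in H, so all of v_1, …, v_j lie in H.
-- Hence a chordless path from A ⊆ H to B ⊆ V(G) ∖ H leaves H exactly once, say after v_i,
-- and H separates A ∪ {v_1, …, v_i} from B ∪ {v_{i+1}, …, v_k}; as both sides of a
-- half-space are convex, H separates their closures too. The converse holds because
-- separability passes to subsets.
module Submission where

open import Defs
open import Data.Nat using (ℕ; zero; suc; _+_; _∸_; _≤_; _<_; z≤n; s≤s)
open import Data.Nat.Properties
  using ( ≤-refl; ≤-trans; <⇒≤; <⇒≱; <-cmp; m<n⇒m<1+n; m≤n⇒m<n∨m≡n; suc-injective
        ; +-cancelʳ-≡; +-monoˡ-≤; +-monoˡ-<; m≤m+n; m≤n+m; m<m+n; m⊓n≤n; m≤n⇒m⊓n≡m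
        ; m+[n∸m]≡n; m∸n+n≡m; m+n≤o⇒m≤o∸n )
open import Data.Fin using (Fin; zero; suc; toℕ; fromℕ; fromℕ<; inject₁; inject≤)
open import Data.Fin.Properties
  using ( toℕ-injective; toℕ<n; toℕ≤pred[n]; toℕ-fromℕ; toℕ-fromℕ<; toℕ-inject₁
        ; toℕ-inject≤; toℕ-inject; inject≤-injective; ¬∀⟶∃¬-smallest )
open import Data.Fin.Subset using (Subset; _∈_; _∉_; ∁; Nonempty)
open import Data.Fin.Subset.Properties using (_∈?_; x∉p⇒x∈∁p; x∈∁p⇒x∉p)
open import Data.Product using (Σ; _×_; _,_; proj₁)
open import Data.Sum using (_⊎_; inj₁; inj₂; [_,_])
open import Data.Empty using (⊥-elim)
open import Function using (_∘_)
open import Function.Bundles using (_⇔_; mk⇔)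
open import Relation.Binary.Definitions using (tri<; tri≈; tri>)
open import Relation.Binary.PropositionalEquality
  using (_≡_; refl; sym; trans; cong; subst; subst₂; module ≡-Reasoning)
open import Relation.Nullary using (¬_)

clamp : (m t : ℕ) → Fin (suc m)
clamp m t = fromℕ< (s≤s (m⊓n≤n t m))

toℕ-clamp : ∀ {m t} → t ≤ m → toℕ (clamp m t) ≡ t
toℕ-clamp t≤m = trans (toℕ-fromℕ< _) (m≤n⇒m⊓n≡m t≤m)

clamp-toℕ : ∀ {m t} (i : Fin (suc m)) → toℕ i ≡ t → clamp m t ≡ i
clamp-toℕ i refl = toℕ-injective (toℕ-clamp (toℕ≤pred[n] i))

-- Positions of the path that jumps from position k directly to k + 1 + d.
skip : (k d t : ℕ) → ℕ
skip zero    d zero    = zero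
skip zero    d (suc t) = suc t + d
skip (suc k) d zero    = zero
skip (suc k) d (suc t) = suc (skip k d t)

skip-≤ : ∀ {k t} d → t ≤ k → skip k d t ≡ t
skip-≤ {zero}  d z≤n       = refl
skip-≤ {suc k} d z≤n       = refl
skip-≤ {suc k} d (s≤s t≤k) = cong suc (skip-≤ d t≤k)

skip-> : ∀ {k t} d → k < t → skip k d t ≡ t + d
skip-> {zero}  {suc t} d _         = refl
skip-> {suc k} {suc t} d (s≤s k<t) = cong suc (skip-> d k<t)

skip≤+ : ∀ k d t → skip k d t ≤ t + d
skip≤+ zero    d zero    = z≤n
skip≤+ zero    d (suc t) = ≤-refl
skip≤+ (suc k) d zero    = z≤n
skip≤+ (suc k) d (suc t) = s≤s (skip≤+ k d t)

skip-injective : ∀ k d {x y} → skip k d x ≡ skip k d y → x ≡ y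
skip-injective zero    d {zero}  {zero}  _  = refl
skip-injective zero    d {suc x} {suc y} eq = cong suc (+-cancelʳ-≡ d x y (suc-injective eq))
skip-injective (suc k) d {zero}  {zero}  _  = refl
skip-injective (suc k) d {suc x} {suc y} eq = cong suc (skip-injective k d (suc-injective eq))

module _ {n : ℕ} (G : Graph n) where
  open Graph G

  -- Paths indexed by naturals, so that their positions can be rearranged by arithmetic.
  IsPathℕ : ℕ → (ℕ → Fin n) → Set
  IsPathℕ m P = (∀ {x y} → x ≤ m → y ≤ m → P x ≡ P y → x ≡ y)
              × (∀ {t} → t < m → P t ~ P (suc t))

  IsPath⇒IsPathℕ : ∀ {m} {p : Fin (suc m) → Fin n} → IsPath G p → IsPathℕ m (p ∘ clamp m)
  IsPath⇒IsPathℕ {m} {p} (injective , adjacent) = injectiveℕ , adjacentℕ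
    where
    injectiveℕ : ∀ {x y} → x ≤ m → y ≤ m → p (clamp m x) ≡ p (clamp m y) → x ≡ y
    injectiveℕ x≤m y≤m eq =
      trans (sym (toℕ-clamp x≤m)) (trans (cong toℕ (injective eq)) (toℕ-clamp y≤m))

    adjacentℕ : ∀ {t} → t < m → p (clamp m t) ~ p (clamp m (suc t))
    adjacentℕ t<m = subst₂ (λ u v → p u ~ p v)
      (sym (clamp-toℕ (inject₁ i) (trans (toℕ-inject₁ i) (toℕ-fromℕ< t<m))))
      (sym (clamp-toℕ (suc i) (cong suc (toℕ-fromℕ< t<m))))
      (adjacent i)
      where
      i : Fin m
      i = fromℕ< t<m

  IsPathℕ⇒IsPath : ∀ {m P} → IsPathℕ m P → IsPath G {m} (P ∘ toℕ)
  IsPathℕ⇒IsPath {m} {P} (injective , adjacent) =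
    (λ {i} {j} eq → toℕ-injective (injective (toℕ≤pred[n] i) (toℕ≤pred[n] j) eq)) ,
    (λ i → subst (λ t → P t ~ P (suc (toℕ i))) (sym (toℕ-inject₁ i)) (adjacent (toℕ<n i)))

  skip-path : ∀ {m′ d k P} → IsPathℕ (m′ + d) P → k < m′ → P k ~ P (suc k + d) →
              IsPathℕ m′ (P ∘ skip k d)
  skip-path {m′} {d} {k} {P} (injective , adjacent) k<m′ chord = injective′ , adjacent′
    where
    bound : ∀ {t} → t ≤ m′ → skip k d t ≤ m′ + d
    bound {t} t≤m′ = ≤-trans (skip≤+ k d t) (+-monoˡ-≤ d t≤m′)

    injective′ : ∀ {x y} → x ≤ m′ → y ≤ m′ → P (skip k d x) ≡ P (skip k d y) → x ≡ y
    injective′ x≤m′ y≤m′ eq = skip-injective k d (injective (bound x≤m′) (bound y≤m′) eq)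

    adjacent′ : ∀ {t} → t < m′ → P (skip k d t) ~ P (skip k d (suc t))
    adjacent′ {t} t<m′ with <-cmp t k
    ... | tri< t<k _ _ = subst₂ (λ u v → P u ~ P v)
      (sym (skip-≤ d (<⇒≤ t<k))) (sym (skip-≤ d t<k)) (adjacent (≤-trans t<m′ (m≤m+n m′ d)))
    ... | tri≈ _ refl _ = subst₂ (λ u v → P u ~ P v)
      (sym (skip-≤ d ≤-refl)) (sym (skip-> d ≤-refl)) chord
    ... | tri> _ _ k<t = subst₂ (λ u v → P u ~ P v)
      (sym (skip-> d k<t)) (sym (skip-> d (m<n⇒m<1+n k<t))) (adjacent (+-monoˡ-< d t<m′))

  shortcut : ∀ {m} {p : Fin (suc m) → Fin n} → IsPath G p →
    ∀ i j → suc (toℕ i) < toℕ j → p i ~ p j →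
    Σ ℕ λ m′ → m′ < m ×
      Σ (Fin (suc m′) → Fin n) λ q → IsPath G q × Ends G q (p zero) (p (fromℕ m))
  shortcut {m} {p} path i j long chord =
    m′ , m′<m , P ∘ skip k d ∘ toℕ ,
    IsPathℕ⇒IsPath (skip-path pathℕ k<m′ chordℕ) , first , last
    where
    k d m′ : ℕ
    k = toℕ i
    d = toℕ j ∸ suc k
    m′ = m ∸ d

    P : ℕ → Fin n
    P = p ∘ clamp m

    j≡ : suc k + d ≡ toℕ j
    j≡ = m+[n∸m]≡n (<⇒≤ long)

    j≤m : suc k + d ≤ m
    j≤m = subst (_≤ m) (sym j≡) (toℕ≤pred[n] j)

    m≡ : m′ + d ≡ m
    m≡ = m∸n+n≡m (≤-trans (m≤n+m d (suc k)) j≤m)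

    k<m′ : k < m′
    k<m′ = m+n≤o⇒m≤o∸n (suc k) j≤m

    m′<m : m′ < m
    m′<m = subst (m′ <_) m≡ (m<m+n m′ (m+n≤o⇒m≤o∸n 1 long))

    pathℕ : IsPathℕ (m′ + d) P
    pathℕ = subst (λ l → IsPathℕ l P) (sym m≡) (IsPath⇒IsPathℕ path)

    chordℕ : P k ~ P (suc k + d)
    chordℕ = subst₂ _~_
      (sym (cong p (clamp-toℕ i refl))) (sym (cong p (clamp-toℕ j (sym j≡)))) chord

    first : P (skip k d 0) ≡ p zero
    first = trans (cong P (skip-≤ {k} d z≤n)) (cong p (clamp-toℕ zero refl))

    last : P (skip k d (toℕ (fromℕ m′))) ≡ p (fromℕ m)
    last = begin
      P (skip k d (toℕ (fromℕ m′))) ≡⟨ cong (P ∘ skip k d) (toℕ-fromℕ m′) ⟩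
      P (skip k d m′)               ≡⟨ cong P (skip-> d k<m′) ⟩
      P (m′ + d)                    ≡⟨ cong P m≡ ⟩
      P m                           ≡⟨ cong p (clamp-toℕ (fromℕ m) (toℕ-fromℕ m)) ⟩
      p (fromℕ m)                   ∎
      where open ≡-Reasoning

  shortest⇒chordless : ∀ {m} {p : Fin (suc m) → Fin n} {a b} →
                       IsShortestPath G p a b → IsChordless G p
  shortest⇒chordless {p = p} (path , (start , end) , minimal) = path , adjacent⇒consecutive
    where
    no-long-chord : ∀ i j → suc (toℕ i) < toℕ j → ¬ p i ~ p j
    no-long-chord i j long chord with shortcut path i j long chord
    ... | m′ , m′<m , q , q-path , (q-start , q-end) =
      <⇒≱ m′<m (minimal m′ q q-path (trans q-start start , trans q-end end))

    consecutive : ∀ i j → toℕ i < toℕ j → p i ~ p j → toℕ j ≡ suc (toℕ i)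
    consecutive i j i<j chord with m≤n⇒m<n∨m≡n i<j
    ... | inj₁ long = ⊥-elim (no-long-chord i j long chord)
    ... | inj₂ eq   = sym eq

    adjacent⇒consecutive : ∀ i j → p i ~ p j → (toℕ j ≡ suc (toℕ i)) ⊎ (toℕ i ≡ suc (toℕ j))
    adjacent⇒consecutive i j chord with <-cmp (toℕ i) (toℕ j)
    ... | tri< i<j _ _ = inj₁ (consecutive i j i<j chord)
    ... | tri≈ _ i≡j _ =
      ⊥-elim (~-irrefl (p i) (subst (λ x → p i ~ p x) (sym (toℕ-injective i≡j)) chord))
    ... | tri> _ _ j<i = inj₂ (consecutive j i j<i (~-sym chord))

  inject≤-chordless : ∀ {l m} {p : Fin (suc m) → Fin n} → IsChordless G p → (l≤m : l ≤ m) →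
                      IsChordless G {l} (λ x → p (inject≤ x (s≤s l≤m)))
  inject≤-chordless {l} {m} {p} ((injective , adjacent) , chordless) l≤m =
    (injective′ , adjacent′) , chordless′
    where
    ι : Fin (suc l) → Fin (suc m)
    ι x = inject≤ x (s≤s l≤m)

    injective′ : ∀ {x y} → p (ι x) ≡ p (ι y) → x ≡ y
    injective′ eq = inject≤-injective _ _ _ _ (injective eq)

    ι-inject₁ : ∀ x → ι (inject₁ x) ≡ inject₁ (inject≤ x l≤m)
    ι-inject₁ x = toℕ-injective (begin
      toℕ (ι (inject₁ x))               ≡⟨ toℕ-inject≤ (inject₁ x) _ ⟩
      toℕ (inject₁ x)                   ≡⟨ toℕ-inject₁ x ⟩
      toℕ x                             ≡⟨ toℕ-inject≤ x l≤m ⟨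
      toℕ (inject≤ x l≤m)               ≡⟨ toℕ-inject₁ (inject≤ x l≤m) ⟨
      toℕ (inject₁ (inject≤ x l≤m))     ∎)
      where open ≡-Reasoning

    adjacent′ : ∀ x → p (ι (inject₁ x)) ~ p (ι (suc x))
    adjacent′ x = subst (λ y → p y ~ p (ι (suc x))) (sym (ι-inject₁ x)) (adjacent (inject≤ x l≤m))

    chordless′ : ∀ x y → p (ι x) ~ p (ι y) → (toℕ y ≡ suc (toℕ x)) ⊎ (toℕ x ≡ suc (toℕ y))
    chordless′ x y adj = subst₂ (λ u v → (v ≡ suc u) ⊎ (u ≡ suc v))
      (toℕ-inject≤ x _) (toℕ-inject≤ y _) (chordless (ι x) (ι y) adj)

  chordless-stays-in-convex : ∀ {C m} {p : Fin (suc m) → Fin n} → Convex G C → IsChordless G p →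
    C (p zero) → ∀ {i j} → toℕ i ≤ toℕ j → C (p j) → C (p i)
  chordless-stays-in-convex {C} {m} {p} convex chordless start∈ {i} {j} i≤j pj∈ =
    subst C (cong p ι-x≡i) (convex (toℕ j) (p ∘ ι) segment start∈ end∈ x)
    where
    j≤m : toℕ j ≤ m
    j≤m = toℕ≤pred[n] j

    ι : Fin (suc (toℕ j)) → Fin (suc m)
    ι y = inject≤ y (s≤s j≤m)

    segment : IsChordless G (p ∘ ι)
    segment = inject≤-chordless chordless j≤m

    end∈ : C (p (ι (fromℕ (toℕ j))))
    end∈ = subst C (cong p (toℕ-injective
      (sym (trans (toℕ-inject≤ (fromℕ (toℕ j)) _) (toℕ-fromℕ (toℕ j)))))) pj∈

    x : Fin (suc (toℕ j))
    x = fromℕ< (s≤s i≤j)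

    ι-x≡i : ι x ≡ i
    ι-x≡i = toℕ-injective (trans (toℕ-inject≤ x _) (toℕ-fromℕ< (s≤s i≤j)))

  chordless-crosses-once : ∀ {H m} {p : Fin (suc m) → Fin n} → Convex G ⟦ H ⟧ → IsChordless G p →
    p zero ∈ H → p (fromℕ m) ∉ H →
    Σ ℕ λ i → (1 ≤ i) × (i < suc m) × (Prefix p i ⊆ᵥ ⟦ H ⟧) × (Suffix p i ⊆ᵥ ⟦ ∁ H ⟧)
  chordless-crosses-once {H} {m} {p} convex chordless start∈ end∉
    with ¬∀⟶∃¬-smallest (suc m) (λ j → p j ∈ H) (λ j → p j ∈? H)
           (λ all∈ → end∉ (all∈ (fromℕ m)))
  ... | i , pi∉ , before = toℕ i , positive i pi∉ , toℕ<n i , prefix , suffix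
    where
    positive : ∀ j → p j ∉ H → 1 ≤ toℕ j
    positive zero    pj∉ = ⊥-elim (pj∉ start∈)
    positive (suc _) _   = s≤s z≤n

    prefix : Prefix p (toℕ i) ⊆ᵥ ⟦ H ⟧
    prefix _ (j , j<i , refl) =
      subst (_∈ H) (cong p (toℕ-injective (trans (toℕ-inject _) (toℕ-fromℕ< j<i))))
        (before (fromℕ< j<i))

    suffix : Suffix p (toℕ i) ⊆ᵥ ⟦ ∁ H ⟧
    suffix _ (j , i≤j , refl) =
      x∉p⇒x∈∁p λ pj∈ →
        pi∉ (chordless-stays-in-convex {⟦ H ⟧} convex chordless start∈ i≤j pj∈)

  cl-extensive : ∀ {X} → X ⊆ᵥ cl G X
  cl-extensive x x∈X _ _ X⊆C = X⊆C x x∈X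

  cl-least : ∀ {X C} → Convex G ⟦ C ⟧ → X ⊆ᵥ ⟦ C ⟧ → cl G X ⊆ᵥ ⟦ C ⟧
  cl-least convex X⊆C x x∈cl = x∈cl _ convex X⊆C

  separable-⊆ : ∀ {X Y X′ Y′} → X′ ⊆ᵥ X → Y′ ⊆ᵥ Y → Separable G X Y → Separable G X′ Y′
  separable-⊆ X′⊆X Y′⊆Y (H , half , X⊆H , Y⊆∁H) =
    H , half , (λ x → X⊆H x ∘ X′⊆X x) , (λ y → Y⊆∁H y ∘ Y′⊆Y y)

  separable-cl : ∀ {X Y} → Separable G X Y → Separable G (cl G X) (cl G Y)
  separable-cl (H , (convex , co-convex) , X⊆H , Y⊆∁H) =
    H , (convex , co-convex) , cl-least convex X⊆H , cl-least co-convex Y⊆∁H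

lemma8 : ∀ {n} (G : Graph n) → Connected G →
    (A B : Subset n) → Nonempty A → Nonempty B → Disjoint A B →
    Convex G ⟦ A ⟧ → Convex G ⟦ B ⟧ →
    (a b : Fin n) → a ∈ A → b ∈ B →
    (m : ℕ) (p : Fin (suc m) → Fin n) → IsShortestPath G p a b →
    Separable G ⟦ A ⟧ ⟦ B ⟧ ⇔
      (Σ ℕ λ i → (1 ≤ i) × (i < suc m) ×
        Separable G (cl G (⟦ A ⟧ ∪ᵥ Prefix p i)) (cl G (⟦ B ⟧ ∪ᵥ Suffix p i)))
lemma8 G _ A B _ _ _ _ _ a b a∈A b∈B m p shortest@(_ , (start , end) , _) =
  mk⇔
    (λ { (H , half , A⊆H , B⊆∁H) →
      let i , 1≤i , i<1+m , prefix , suffix =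
            chordless-crosses-once G (proj₁ half) (shortest⇒chordless G shortest)
              (subst (_∈ H) (sym start) (A⊆H a a∈A))
              (x∈∁p⇒x∉p (subst (_∈ ∁ H) (sym end) (B⊆∁H b b∈B)))
      in i , 1≤i , i<1+m ,
         separable-cl G
           (H , half , (λ x → [ A⊆H x , prefix x ]) , (λ x → [ B⊆∁H x , suffix x ])) })
    (λ { (_ , _ , _ , separable) →
      separable-⊆ G (λ x → cl-extensive G x ∘ inj₁) (λ y → cl-extensive G y ∘ inj₁) separable })
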